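{- For all terms $P,P',P''\in\widehat{\mathcal P}$: if $P\xrightarrow{\sigma}_2P'$ and $P'\xrightarrow{\sigma}_2P''$, then $P\xrightarrow{\sigma}_2P''$.
   Context: TACS. Fix a countable set $\Lambda$ of action names; $\overline{\Lambda}=\{\overline a : a\in\Lambda\}$ with $\overline{\overline a}=a$; $\mathcal A=\Lambda\cup\overline\Lambda\cup\{\tau\}$, and $a$ ranges over $\Lambda\cup\overline\Lambda$. Terms (set $\widehat{\mathcal P}$, possibly open) are generated by $P::=\mathbf 0\mid x\mid \alpha.P\mid \sigma.P\mid P+P\mid P|P\mid P\backslash L\mid P[f]\mid \mu x.P$, where $\alpha\in\mathcal A$, $x$ ranges over a countably infinite set of variables, $L\subseteq\mathcal A\setminus\{\tau\}$ is finite, and $f:\mathcal A\to\mathcal A$ satisfies $f(\tau)=\tau$, $f(\overline a)=\overline{f(a)}$ and $f(\alpha)\neq\alpha$ for only finitely many $\alpha$. $\mu x$ binds $x$; $P[Q/x]$ is substitution of $Q$ for the free occurrences of $x$. A variable is guarded in a term if each of its occurrences is in the scope of an action prefix $\alpha.\_$ (a $\sigma$-prefix does not count); in every term $\mu x.P$, $x$ must be guarded in $P$. $\overline L=\{\overline a: a\in L\}$. Urgent sets: $\mathcal U(\sigma.P)=\mathcal U(\mathbf 0)=\mathcal U(x)=\emptyset$, $\mathcal U(\alpha.P)=\{\alpha\}$, $\mathcal U(P+Q)=\mathcal U(P)\cup\mathcal U(Q)$, $\mathcal U(P|Q)=\mathcal U(P)\cup\mathcal U(Q)\cup\{\tau\mid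 \mathcal U(P)\cap\overline{\mathcal U(Q)}\neq\emptyset\}$, $\mathcal U(P\backslash L)=\mathcal U(P)\setminus(L\cup\overline L)$, $\mathcal U(P[f])=\{f(\alpha):\alpha\in\mathcal U(P)\}$, $\mathcal U(\mu x.P)=\mathcal U(P)$. The clock transition relation $\xrightarrow{\sigma}_2$ on terms is the least relation with: $\mathbf 0\xrightarrow{\sigma}_2\mathbf 0$; $a.P\xrightarrow{\sigma}_2 a.P$ for $a\in\Lambda\cup\overline\Lambda$; $\sigma.P\xrightarrow{\sigma}_2P$; if $P\xrightarrow{\sigma}_2P'$ then $\sigma.P\xrightarrow{\sigma}_2P'$, $\mu x.P\xrightarrow{\sigma}_2P'[\mu x.P/x]$, $P\backslash L\xrightarrow{\sigma}_2P'\backslash L$, $P[f]\xrightarrow{\sigma}_2P'[f]$; if $P\xrightarrow{\sigma}_2P'$ and $Q\xrightarrow{\sigma}_2Q'$ then $P+Q\xrightarrow{\sigma}_2P'+Q'$, and $P|Q\xrightarrow{\sigma}_2P'|Q'$ provided $\tau\notin\mathcal U(P|Q)$. -}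

module Defs where

open import Data.Nat using (ℕ; zero; suc)
open import Data.List using (List)
open import Data.List.Membership.Propositional using (_∈_)
open import Data.Product using (Σ; _×_; ∃)
open import Data.Sum using (_⊎_)
open import Data.Unit using (⊤)
open import Data.Empty using (⊥)
open import Relation.Nullary using (¬_)
open import Relation.Binary.PropositionalEquality using (_≡_; _≢_)

-- Action names Λ: a countable set, taken to be ℕ.
-- Visible actions Λ ∪ Λ̄.
data Vis : Set where
  nm  : ℕ → Vis
  co  : ℕ → Vis

bar : Vis → Vis
bar (nm n) = co n
bar (co n) = nm n

data Act : Set where
  vis : Vis → Act
  τ   : Act

-- Since ā must be defined for f a, f maps visible actions to
-- visible actions; we record f on visible actions and extend by f τ = τ.
record Relabel : Set where
  field
    fun       : Vis → Vis
    fun-bar   : ∀ a → fun (bar a) ≡ bar (fun a)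
    finite    : Σ (List Vis) λ D → ∀ a → fun a ≢ a → a ∈ D
open Relabel public

applyR : Relabel → Act → Act
applyR f (vis a) = vis (fun f a)
applyR f τ = τ

-- Restriction sets L ⊆ 𝒜 ∖ {τ}, finite: a list of visible actions.
-- α ∈ L ∪ L̄
_∈L∪L̄_ : Act → List Vis → Set
vis a ∈L∪L̄ L = (a ∈ L) ⊎ (bar a ∈ L)
τ ∈L∪L̄ L = ⊥

-- Terms, with variables as de Bruijn indices (μ binds index 0).
data Term : Set where
  𝟎     : Term
  var   : ℕ → Term
  act   : Act → Term → Term
  σ∙    : Term → Term
  _⊕_   : Term → Term → Term
  _∥_   : Term → Term → Term
  _∖_   : Term → List Vis → Term
  _⟦_⟧  : Term → Relabel → Term
  μ     : Term → Term

Guarded : ℕ → Term → Set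
Guarded i 𝟎 = ⊤
Guarded i (var j) = j ≢ i
Guarded i (act α P) = ⊤
Guarded i (σ∙ P) = Guarded i P
Guarded i (P ⊕ Q) = Guarded i P × Guarded i Q
Guarded i (P ∥ Q) = Guarded i P × Guarded i Q
Guarded i (P ∖ L) = Guarded i P
Guarded i (P ⟦ f ⟧) = Guarded i P
Guarded i (μ P) = Guarded (suc i) P

WF : Term → Set
WF 𝟎 = ⊤
WF (var j) = ⊤
WF (act α P) = WF P
WF (σ∙ P) = WF P
WF (P ⊕ Q) = WF P × WF Q
WF (P ∥ Q) = WF P × WF Q
WF (P ∖ L) = WF P
WF (P ⟦ f ⟧) = WF P
WF (μ P) = Guarded zero P × WF P

ext : (ℕ → ℕ) → ℕ → ℕ
ext ρ zero = zero
ext ρ (suc n) = suc (ρ n)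

rename : (ℕ → ℕ) → Term → Term
rename ρ 𝟎 = 𝟎
rename ρ (var j) = var (ρ j)
rename ρ (act α P) = act α (rename ρ P)
rename ρ (σ∙ P) = σ∙ (rename ρ P)
rename ρ (P ⊕ Q) = rename ρ P ⊕ rename ρ Q
rename ρ (P ∥ Q) = rename ρ P ∥ rename ρ Q
rename ρ (P ∖ L) = rename ρ P ∖ L
rename ρ (P ⟦ f ⟧) = rename ρ P ⟦ f ⟧
rename ρ (μ P) = μ (rename (ext ρ) P)

exts : (ℕ → Term) → ℕ → Term
exts s zero = var zero
exts s (suc n) = rename suc (s n)

subst : (ℕ → Term) → Term → Term
subst s 𝟎 = 𝟎
subst s (var j) = s j
subst s (act α P) = act α (subst s P)
subst s (σ∙ P) = σ∙ (subst s P)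
subst s (P ⊕ Q) = subst s P ⊕ subst s Q
subst s (P ∥ Q) = subst s P ∥ subst s Q
subst s (P ∖ L) = subst s P ∖ L
subst s (P ⟦ f ⟧) = subst s P ⟦ f ⟧
subst s (μ P) = μ (subst (exts s) P)

single : Term → ℕ → Term
single Q zero = Q
single Q (suc n) = var n

_[_/0] : Term → Term → Term
P [ Q /0] = subst (single Q) P

-- Urgent sets, as membership predicates: α ∈U P  means  α ∈ 𝒰(P).
_∈U_ : Act → Term → Set
α ∈U 𝟎 = ⊥
α ∈U var j = ⊥
α ∈U act β P = α ≡ β
α ∈U σ∙ P = ⊥
α ∈U (P ⊕ Q) = α ∈U P ⊎ α ∈U Q
α ∈U (P ∥ Q) = α ∈U P ⊎ α ∈U Q ⊎
               (α ≡ τ × ∃ λ a → vis a ∈U P × vis (bar a) ∈U Q)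
α ∈U (P ∖ L) = α ∈U P × ¬ (α ∈L∪L̄ L)
α ∈U (P ⟦ f ⟧) = ∃ λ β → β ∈U P × applyR f β ≡ α
α ∈U μ P = α ∈U P

data _—σ→₂_ : Term → Term → Set where
  nil   : 𝟎 —σ→₂ 𝟎
  pre   : ∀ a P → act (vis a) P —σ→₂ act (vis a) P
  sig   : ∀ P → σ∙ P —σ→₂ P
  sig′  : ∀ {P P'} → P —σ→₂ P' → σ∙ P —σ→₂ P'
  rec   : ∀ {P P'} → P —σ→₂ P' → μ P —σ→₂ (P' [ μ P /0])
  res   : ∀ {P P'} L → P —σ→₂ P' → (P ∖ L) —σ→₂ (P' ∖ L)
  rel   : ∀ {P P'} f → P —σ→₂ P' → (P ⟦ f ⟧) —σ→₂ (P' ⟦ f ⟧)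
  sum   : ∀ {P P' Q Q'} → P —σ→₂ P' → Q —σ→₂ Q' → (P ⊕ Q) —σ→₂ (P' ⊕ Q')
  par   : ∀ {P P' Q Q'} → P —σ→₂ P' → Q —σ→₂ Q' → ¬ (τ ∈U (P ∥ Q)) →
          (P ∥ Q) —σ→₂ (P' ∥ Q')

-- The only non-trivial case is recursion:
-- from μx.P —σ→ P'[μx.P/x] —σ→ P'', we must find the second step inside P'.
-- Clock steps preserve guardedness, so x is still guarded in P'; hence every
-- copy of μx.P in P'[μx.P/x] sits under an action prefix, which idles on σ
-- without looking at its continuation, and the step of P'[μx.P/x] is the image
-- of a step P' —σ→ T' with P'' = T'[μx.P/x].  Substitution only enlarges
-- urgent sets, so the side condition of parallel composition survives this.
module Submission where

open import Defs
open import Data.Nat using (ℕ; zero; suc)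
open import Data.Nat.Properties using (_≟_; suc-injective)
open import Data.Product using (_×_; _,_; ∃; proj₁; proj₂)
open import Data.Sum as Sum using (_⊎_; inj₁; inj₂)
open import Data.Empty using (⊥-elim)
open import Function using (_∘_; id)
open import Relation.Nullary using (¬_; yes; no)
open import Relation.Binary.PropositionalEquality as ≡
  using (_≡_; _≢_; _≗_; refl; sym; trans; cong; cong₂; module ≡-Reasoning)

ext-cong : ∀ {ρ ρ'} → ρ ≗ ρ' → ext ρ ≗ ext ρ'
ext-cong e zero = refl
ext-cong e (suc n) = cong suc (e n)

rename-cong : ∀ {ρ ρ'} → ρ ≗ ρ' → rename ρ ≗ rename ρ'
rename-cong e 𝟎 = refl
rename-cong e (var j) = cong var (e j)
rename-cong e (act α P) = cong (act α) (rename-cong e P)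
rename-cong e (σ∙ P) = cong σ∙ (rename-cong e P)
rename-cong e (P ⊕ Q) = cong₂ _⊕_ (rename-cong e P) (rename-cong e Q)
rename-cong e (P ∥ Q) = cong₂ _∥_ (rename-cong e P) (rename-cong e Q)
rename-cong e (P ∖ L) = cong (_∖ L) (rename-cong e P)
rename-cong e (P ⟦ f ⟧) = cong (_⟦ f ⟧) (rename-cong e P)
rename-cong e (μ P) = cong μ (rename-cong (ext-cong e) P)

exts-cong : ∀ {s s'} → s ≗ s' → exts s ≗ exts s'
exts-cong e zero = refl
exts-cong e (suc n) = cong (rename suc) (e n)

subst-cong : ∀ {s s'} → s ≗ s' → subst s ≗ subst s'
subst-cong e 𝟎 = refl
subst-cong e (var j) = e j
subst-cong e (act α P) = cong (act α) (subst-cong e P)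
subst-cong e (σ∙ P) = cong σ∙ (subst-cong e P)
subst-cong e (P ⊕ Q) = cong₂ _⊕_ (subst-cong e P) (subst-cong e Q)
subst-cong e (P ∥ Q) = cong₂ _∥_ (subst-cong e P) (subst-cong e Q)
subst-cong e (P ∖ L) = cong (_∖ L) (subst-cong e P)
subst-cong e (P ⟦ f ⟧) = cong (_⟦ f ⟧) (subst-cong e P)
subst-cong e (μ P) = cong μ (subst-cong (exts-cong e) P)

rename-rename : ∀ ρ ρ' T → rename ρ (rename ρ' T) ≡ rename (ρ ∘ ρ') T
rename-rename ρ ρ' 𝟎 = refl
rename-rename ρ ρ' (var j) = refl
rename-rename ρ ρ' (act α P) = cong (act α) (rename-rename ρ ρ' P)
rename-rename ρ ρ' (σ∙ P) = cong σ∙ (rename-rename ρ ρ' P)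
rename-rename ρ ρ' (P ⊕ Q) = cong₂ _⊕_ (rename-rename ρ ρ' P) (rename-rename ρ ρ' Q)
rename-rename ρ ρ' (P ∥ Q) = cong₂ _∥_ (rename-rename ρ ρ' P) (rename-rename ρ ρ' Q)
rename-rename ρ ρ' (P ∖ L) = cong (_∖ L) (rename-rename ρ ρ' P)
rename-rename ρ ρ' (P ⟦ f ⟧) = cong (_⟦ f ⟧) (rename-rename ρ ρ' P)
rename-rename ρ ρ' (μ P) =
  cong μ (trans (rename-rename (ext ρ) (ext ρ') P) (rename-cong ext-∘ P))
  where
  ext-∘ : ext ρ ∘ ext ρ' ≗ ext (ρ ∘ ρ')
  ext-∘ zero = refl
  ext-∘ (suc n) = refl

subst-rename : ∀ s ρ T → subst s (rename ρ T) ≡ subst (s ∘ ρ) T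
subst-rename s ρ 𝟎 = refl
subst-rename s ρ (var j) = refl
subst-rename s ρ (act α P) = cong (act α) (subst-rename s ρ P)
subst-rename s ρ (σ∙ P) = cong σ∙ (subst-rename s ρ P)
subst-rename s ρ (P ⊕ Q) = cong₂ _⊕_ (subst-rename s ρ P) (subst-rename s ρ Q)
subst-rename s ρ (P ∥ Q) = cong₂ _∥_ (subst-rename s ρ P) (subst-rename s ρ Q)
subst-rename s ρ (P ∖ L) = cong (_∖ L) (subst-rename s ρ P)
subst-rename s ρ (P ⟦ f ⟧) = cong (_⟦ f ⟧) (subst-rename s ρ P)
subst-rename s ρ (μ P) =
  cong μ (trans (subst-rename (exts s) (ext ρ) P) (subst-cong exts-∘-ext P))
  where
  exts-∘-ext : exts s ∘ ext ρ ≗ exts (s ∘ ρ)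
  exts-∘-ext zero = refl
  exts-∘-ext (suc n) = refl

rename-subst : ∀ ρ s T → rename ρ (subst s T) ≡ subst (rename ρ ∘ s) T
rename-subst ρ s 𝟎 = refl
rename-subst ρ s (var j) = refl
rename-subst ρ s (act α P) = cong (act α) (rename-subst ρ s P)
rename-subst ρ s (σ∙ P) = cong σ∙ (rename-subst ρ s P)
rename-subst ρ s (P ⊕ Q) = cong₂ _⊕_ (rename-subst ρ s P) (rename-subst ρ s Q)
rename-subst ρ s (P ∥ Q) = cong₂ _∥_ (rename-subst ρ s P) (rename-subst ρ s Q)
rename-subst ρ s (P ∖ L) = cong (_∖ L) (rename-subst ρ s P)
rename-subst ρ s (P ⟦ f ⟧) = cong (_⟦ f ⟧) (rename-subst ρ s P)
rename-subst ρ s (μ P) =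
  cong μ (trans (rename-subst (ext ρ) (exts s) P) (subst-cong ext-∘-exts P))
  where
  ext-∘-exts : rename (ext ρ) ∘ exts s ≗ exts (rename ρ ∘ s)
  ext-∘-exts zero = refl
  ext-∘-exts (suc n) =
    trans (rename-rename (ext ρ) suc (s n)) (sym (rename-rename suc ρ (s n)))

subst-subst : ∀ s s' T → subst s (subst s' T) ≡ subst (subst s ∘ s') T
subst-subst s s' 𝟎 = refl
subst-subst s s' (var j) = refl
subst-subst s s' (act α P) = cong (act α) (subst-subst s s' P)
subst-subst s s' (σ∙ P) = cong σ∙ (subst-subst s s' P)
subst-subst s s' (P ⊕ Q) = cong₂ _⊕_ (subst-subst s s' P) (subst-subst s s' Q)
subst-subst s s' (P ∥ Q) = cong₂ _∥_ (subst-subst s s' P) (subst-subst s s' Q)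
subst-subst s s' (P ∖ L) = cong (_∖ L) (subst-subst s s' P)
subst-subst s s' (P ⟦ f ⟧) = cong (_⟦ f ⟧) (subst-subst s s' P)
subst-subst s s' (μ P) =
  cong μ (trans (subst-subst (exts s) (exts s') P) (subst-cong exts-∘-exts P))
  where
  exts-∘-exts : subst (exts s) ∘ exts s' ≗ exts (subst s ∘ s')
  exts-∘-exts zero = refl
  exts-∘-exts (suc n) =
    trans (subst-rename (exts s) suc (s' n)) (sym (rename-subst suc s (s' n)))

subst-var : ∀ T → subst var T ≡ T
subst-var 𝟎 = refl
subst-var (var j) = refl
subst-var (act α P) = cong (act α) (subst-var P)
subst-var (σ∙ P) = cong σ∙ (subst-var P)
subst-var (P ⊕ Q) = cong₂ _⊕_ (subst-var P) (subst-var Q)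
subst-var (P ∥ Q) = cong₂ _∥_ (subst-var P) (subst-var Q)
subst-var (P ∖ L) = cong (_∖ L) (subst-var P)
subst-var (P ⟦ f ⟧) = cong (_⟦ f ⟧) (subst-var P)
subst-var (μ P) = cong μ (trans (subst-cong exts-var P) (subst-var P))
  where
  exts-var : exts var ≗ var
  exts-var zero = refl
  exts-var (suc n) = refl

subst-[/0] : ∀ s T U → subst s (T [ U /0]) ≡ subst (exts s) T [ subst s U /0]
subst-[/0] s T U = begin
  subst s (subst (single U) T)                   ≡⟨ subst-subst s (single U) T ⟩
  subst (subst s ∘ single U) T                   ≡⟨ subst-cong pointwise T ⟩
  subst (subst (single (subst s U)) ∘ exts s) T  ≡⟨ sym (subst-subst _ (exts s) T) ⟩
  subst (exts s) T [ subst s U /0]               ∎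
  where
  open ≡-Reasoning
  pointwise : subst s ∘ single U ≗ subst (single (subst s U)) ∘ exts s
  pointwise zero = refl
  pointwise (suc n) =
    sym (trans (subst-rename (single (subst s U)) suc (s n)) (subst-var (s n)))

AllUnguarded : (ℕ → Set) → Term → Set
AllUnguarded Q T = ∀ j → Guarded j T ⊎ Q j

AllUnguarded-proj₁ : ∀ {A B Q : ℕ → Set} →
                     (∀ j → A j × B j ⊎ Q j) → ∀ j → A j ⊎ Q j
AllUnguarded-proj₁ h = Sum.map₁ proj₁ ∘ h

AllUnguarded-proj₂ : ∀ {A B Q : ℕ → Set} →
                     (∀ j → A j × B j ⊎ Q j) → ∀ j → B j ⊎ Q j
AllUnguarded-proj₂ h = Sum.map₁ proj₂ ∘ h

AllUnguarded-μ : ∀ {Q Q' : ℕ → Set} P → Q' zero → (∀ {k} → Q k → Q' (suc k)) →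
                 AllUnguarded Q (μ P) → AllUnguarded Q' P
AllUnguarded-μ P q₀ q₊ h zero = inj₂ q₀
AllUnguarded-μ P q₀ q₊ h (suc k) = Sum.map₂ q₊ (h k)

guarded-rename : ∀ ρ i T → AllUnguarded (λ j → ρ j ≢ i) T → Guarded i (rename ρ T)
guarded-rename ρ i 𝟎 h = _
guarded-rename ρ i (var j) h = Sum.[ (λ g → ⊥-elim (g refl)) , id ] (h j)
guarded-rename ρ i (act α P) h = _
guarded-rename ρ i (σ∙ P) h = guarded-rename ρ i P h
guarded-rename ρ i (P ⊕ Q) h =
  guarded-rename ρ i P (AllUnguarded-proj₁ h) , guarded-rename ρ i Q (AllUnguarded-proj₂ h)
guarded-rename ρ i (P ∥ Q) h =
  guarded-rename ρ i P (AllUnguarded-proj₁ h) , guarded-rename ρ i Q (AllUnguarded-proj₂ h)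
guarded-rename ρ i (P ∖ L) h = guarded-rename ρ i P h
guarded-rename ρ i (P ⟦ f ⟧) h = guarded-rename ρ i P h
guarded-rename ρ i (μ P) h =
  guarded-rename (ext ρ) (suc i) P (AllUnguarded-μ P (λ ()) (λ ne → ne ∘ suc-injective) h)

guarded-rename-suc : ∀ i T → Guarded i T → Guarded (suc i) (rename suc T)
guarded-rename-suc i T g = guarded-rename suc (suc i) T unguarded
  where
  unguarded : AllUnguarded (λ j → suc j ≢ suc i) T
  unguarded j with j ≟ i
  ... | yes refl = inj₁ g
  ... | no j≢i = inj₂ (j≢i ∘ suc-injective)

guarded-subst : ∀ s i T → AllUnguarded (Guarded i ∘ s) T → Guarded i (subst s T)
guarded-subst s i 𝟎 h = _
guarded-subst s i (var j) h = Sum.[ (λ g → ⊥-elim (g refl)) , id ] (h j)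
guarded-subst s i (act α P) h = _
guarded-subst s i (σ∙ P) h = guarded-subst s i P h
guarded-subst s i (P ⊕ Q) h =
  guarded-subst s i P (AllUnguarded-proj₁ h) , guarded-subst s i Q (AllUnguarded-proj₂ h)
guarded-subst s i (P ∥ Q) h =
  guarded-subst s i P (AllUnguarded-proj₁ h) , guarded-subst s i Q (AllUnguarded-proj₂ h)
guarded-subst s i (P ∖ L) h = guarded-subst s i P h
guarded-subst s i (P ⟦ f ⟧) h = guarded-subst s i P h
guarded-subst s i (μ P) h =
  guarded-subst (exts s) (suc i) P
    (AllUnguarded-μ P (λ ()) (λ {k} → guarded-rename-suc i (s k)) h)

guarded-step : ∀ {P P'} i → Guarded i P → P —σ→₂ P' → Guarded i P'
guarded-step i g nil = g
guarded-step i g (pre a P) = g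
guarded-step i g (sig P) = g
guarded-step i g (sig′ d) = guarded-step i g d
guarded-step i g (rec {P} {P'} d) = guarded-subst (single (μ P)) i P' unguarded
  where
  unguarded : AllUnguarded (Guarded i ∘ single (μ P)) P'
  unguarded zero = inj₂ g
  unguarded (suc k) with k ≟ i
  ... | yes refl = inj₁ (guarded-step (suc i) g d)
  ... | no k≢i = inj₂ k≢i
guarded-step i g (res L d) = guarded-step i g d
guarded-step i g (rel f d) = guarded-step i g d
guarded-step i (g₁ , g₂) (sum d e) = guarded-step i g₁ d , guarded-step i g₂ e
guarded-step i (g₁ , g₂) (par d e _) = guarded-step i g₁ d , guarded-step i g₂ e

∈U-subst : ∀ s {α} T → α ∈U T → α ∈U subst s T
∈U-subst s (act β P) u = u
∈U-subst s (P ⊕ Q) (inj₁ u) = inj₁ (∈U-subst s P u)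
∈U-subst s (P ⊕ Q) (inj₂ u) = inj₂ (∈U-subst s Q u)
∈U-subst s (P ∥ Q) (inj₁ u) = inj₁ (∈U-subst s P u)
∈U-subst s (P ∥ Q) (inj₂ (inj₁ u)) = inj₂ (inj₁ (∈U-subst s Q u))
∈U-subst s (P ∥ Q) (inj₂ (inj₂ (α≡τ , a , u₁ , u₂))) =
  inj₂ (inj₂ (α≡τ , a , ∈U-subst s P u₁ , ∈U-subst s Q u₂))
∈U-subst s (P ∖ L) (u , α∉L) = ∈U-subst s P u , α∉L
∈U-subst s (P ⟦ f ⟧) (β , u , fβ≡α) = β , ∈U-subst s P u , fβ≡α
∈U-subst s (μ P) u = ∈U-subst (exts s) P u

IsVar : Term → Set
IsVar T = ∃ λ k → T ≡ var k

var-stuck : ∀ {k R} → ¬ (var k —σ→₂ R)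
var-stuck ()

subst-step-inv : ∀ s T {R} → AllUnguarded (IsVar ∘ s) T → subst s T —σ→₂ R →
                 ∃ λ T' → T —σ→₂ T' × R ≡ subst s T'
subst-step-inv s 𝟎 h nil = 𝟎 , nil , refl
subst-step-inv s (var j) h d with h j
... | inj₁ unguarded = ⊥-elim (unguarded refl)
... | inj₂ (k , sj≡var) = ⊥-elim (var-stuck (≡.subst (_—σ→₂ _) sj≡var d))
subst-step-inv s (act (vis a) P) h (pre .a .(subst s P)) = act (vis a) P , pre a P , refl
subst-step-inv s (σ∙ P) h (sig .(subst s P)) = P , sig P , refl
subst-step-inv s (σ∙ P) h (sig′ d) with subst-step-inv s P h d
... | T' , d' , eq = T' , sig′ d' , eq
subst-step-inv s (P ⊕ Q) h (sum d e)
  with subst-step-inv s P (AllUnguarded-proj₁ h) d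
     | subst-step-inv s Q (AllUnguarded-proj₂ h) e
... | P' , d' , eq₁ | Q' , e' , eq₂ = P' ⊕ Q' , sum d' e' , cong₂ _⊕_ eq₁ eq₂
subst-step-inv s (P ∥ Q) h (par d e no-τ)
  with subst-step-inv s P (AllUnguarded-proj₁ h) d
     | subst-step-inv s Q (AllUnguarded-proj₂ h) e
... | P' , d' , eq₁ | Q' , e' , eq₂ =
  P' ∥ Q' , par d' e' (no-τ ∘ ∈U-subst s (P ∥ Q)) , cong₂ _∥_ eq₁ eq₂
subst-step-inv s (P ∖ L) h (res .L d) with subst-step-inv s P h d
... | P' , d' , eq = P' ∖ L , res L d' , cong (_∖ L) eq
subst-step-inv s (P ⟦ f ⟧) h (rel .f d) with subst-step-inv s P h d
... | P' , d' , eq = P' ⟦ f ⟧ , rel f d' , cong (_⟦ f ⟧) eq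
subst-step-inv s (μ P) h (rec d)
  with subst-step-inv (exts s) P (AllUnguarded-μ P (zero , refl) rename-suc-var h) d
  where
  rename-suc-var : ∀ {k} → IsVar (s k) → IsVar (rename suc (s k))
  rename-suc-var (m , eq) = suc m , cong (rename suc) eq
... | P' , d' , refl = P' [ μ P /0] , rec d' , sym (subst-[/0] s P' (μ P))

μ-unfold-step-inv : ∀ {P P' R} → Guarded zero P → P —σ→₂ P' → (P' [ μ P /0]) —σ→₂ R →
                    ∃ λ P'' → P' —σ→₂ P'' × R ≡ P'' [ μ P /0]
μ-unfold-step-inv {P} {P'} g d = subst-step-inv (single (μ P)) P' unguarded
  where
  unguarded : AllUnguarded (IsVar ∘ single (μ P)) P'
  unguarded zero = inj₁ (guarded-step zero g d)
  unguarded (suc k) = inj₂ (k , refl)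

proposition2 : ∀ {P P' P''} → WF P → P —σ→₂ P' → P' —σ→₂ P'' → P —σ→₂ P''
proposition2 _ nil nil = nil
proposition2 _ (pre a P) d' = d'
proposition2 _ (sig P) d' = sig′ d'
proposition2 w (sig′ d) d' = sig′ (proposition2 w d d')
proposition2 (g , w) (rec d) d' with μ-unfold-step-inv g d d'
... | _ , d″ , refl = rec (proposition2 w d d″)
proposition2 w (res L d) (res .L d') = res L (proposition2 w d d')
proposition2 w (rel f d) (rel .f d') = rel f (proposition2 w d d')
proposition2 (w₁ , w₂) (sum d e) (sum d' e') =
  sum (proposition2 w₁ d d') (proposition2 w₂ e e')
proposition2 (w₁ , w₂) (par d e no-τ) (par d' e' _) =
  par (proposition2 w₁ d d') (proposition2 w₂ e e') no-τ
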